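{- Let $G=(V,E)$ be a hypergraph and $\mathcal{P}=(V_1,V_2)$ a minimum cut. Then, for every non-empty subset $T\subseteq V_2$, there exists a subset $S\subseteq V_1$ with $|S|\le 2$ such that the source minimal minimum $(S,T)$-terminal cut $(A,\overline{A})$ satisfies $\delta(A)=\delta(V_1)$ and $A\subseteq V_1$.
   Context: A hypergraph $G=(V,E)$ consists of a finite vertex set $V$ and a finite multiset $E$ of hyperedges, each a subset of $V$ (unit costs). For $U\subseteq V$, $\overline{U}:=V\setminus U$, $\delta(U)$ is the set of hyperedges intersecting both $U$ and $\overline{U}$, and $d(U):=|\delta(U)|$. A cut is a partition $(V_1,V_2)$ of $V$ into two non-empty parts, with cost $d(V_1)$; a minimum cut is one of minimum cost. For disjoint non-empty $S,T\subseteq V$, a $2$-partition $(A,\overline{A})$ is an $(S,T)$-terminal cut if $S\subseteq A\subseteq V\setminus T$; it is a minimum $(S,T)$-terminal cut if it minimizes $d(A)$ among such cuts. The source minimal minimum $(S,T)$-terminal cut is the unique minimum $(S,T)$-terminal cut whose source set $A$ is contained in the source set of every minimum $(S,T)$-terminal cut. -}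

module Defs where

open import Data.Nat using (ℕ; _≤_)
open import Data.Fin using (Fin)
open import Data.Bool using (Bool)
open import Data.Vec using (tabulate)
open import Data.Product using (_×_)
open import Relation.Nullary.Decidable using (does; _×-dec_)
open import Data.Fin.Subset using (Subset; _⊆_; ∁; _∩_; ∣_∣; Nonempty; Empty)
open import Data.Fin.Subset.Properties using (nonempty?)

-- A hypergraph with vertex set Fin n and a multiset of m hyperedges,
-- given as an indexed family (hyperedge occurrence i ↦ its vertex set).
record Hypergraph : Set where
  field
    n : ℕ
    m : ℕ
    edge : Fin m → Subset n
open Hypergraph public

Crosses : {n : ℕ} → Subset n → Subset n → Set
Crosses U e = Nonempty (e ∩ U) × Nonempty (e ∩ ∁ U)

crosses? : {n : ℕ} → Subset n → Subset n → Bool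
crosses? U e = does (nonempty? (e ∩ U) ×-dec nonempty? (e ∩ ∁ U))

δ : (G : Hypergraph) → Subset (n G) → Subset (m G)
δ G U = tabulate (λ i → crosses? U (edge G i))

d : (G : Hypergraph) → Subset (n G) → ℕ
d G U = ∣ δ G U ∣

IsCut : (G : Hypergraph) → Subset (n G) → Set
IsCut G U = Nonempty U × Nonempty (∁ U)

IsMinCut : (G : Hypergraph) → Subset (n G) → Set
IsMinCut G U = IsCut G U × ((U' : Subset (n G)) → IsCut G U' → d G U ≤ d G U')

IsTerminalCut : (G : Hypergraph) → (S T A : Subset (n G)) → Set
IsTerminalCut G S T A = S ⊆ A × A ⊆ ∁ T

IsMinTerminalCut : (G : Hypergraph) → (S T A : Subset (n G)) → Set
IsMinTerminalCut G S T A =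
  IsTerminalCut G S T A ×
  ((A' : Subset (n G)) → IsTerminalCut G S T A' → d G A ≤ d G A')

IsSourceMinimalMinTerminalCut : (G : Hypergraph) → (S T A : Subset (n G)) → Set
IsSourceMinimalMinTerminalCut G S T A =
  IsMinTerminalCut G S T A ×
  ((A' : Subset (n G)) → IsMinTerminalCut G S T A' → A ⊆ A')

{-# OPTIONS --safe #-}
module Submission where

-- Let λ = d(V₁) and let A be an inclusion-minimal non-empty subset of V₁ with δ(A) = δ(V₁);
-- call a minimum cut Z ⊆ A with Z ≠ A proper.  If some pair s, u ∈ A lies in no proper
-- minimum cut, then for every minimum ({s, u}, T)-terminal cut B submodularity makes A ∩ B
-- a minimum cut through s and u, so A ⊆ B and A is the source minimal one for S = {s, u}.
-- Such a pair exists: otherwise, as the union of two intersecting minimum cuts inside A is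
-- again one, maximal proper minimum cuts produce three proper ones X₀, X₁, X₂ any two of
-- which cover A.  Counting hyperedges over the Venn regions of A, X₀, X₁, X₂ gives
-- |δ(A) ∖ δ(X₀)| + Σ d(A ∖ Xᵢ) ≤ Σ d(Xᵢ), and d(A ∖ Xᵢ) ≥ λ ≥ d(Xᵢ) forces δ(X₀) = δ(A),
-- contradicting the minimality of A.

open import Defs
open import Data.Nat using (ℕ; zero; suc; _+_; _≤_; _<_; _≤?_; z≤n; s≤s)
open import Data.Nat.Induction using (<-wellFounded)
open import Data.Nat.Properties
  using (+-0-commutativeMonoid; +-mono-≤; +-monoˡ-≤; +-monoʳ-≤; +-cancelˡ-≤; +-cancelʳ-≤; +-comm; +-suc; +-identityʳ;
         ≤-reflexive; ≤-trans; n≤1+n; n≤0⇒n≡0; <⇒≱; module ≤-Reasoning)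
open import Data.Bool using (Bool; true; false; not; _∧_; _∨_; T)
open import Data.Bool.Properties using (T-∧; T-≡) renaming (_≟_ to _≟ᴮ_)
open import Data.Empty using (⊥; ⊥-elim)
open import Data.Fin using (Fin; zero; suc)
open import Data.Fin.Patterns using (0F; 1F; 2F; 3F; 4F)
open import Data.Fin.Properties using (any?; ¬∀⟶∃¬)
open import Data.Fin.Subset using (Subset; _∈_; _∉_; _⊆_; _⊈_; ∁; _∩_; _∪_; ∣_∣; Nonempty; ⁅_⁆)
open import Data.Fin.Subset.Properties
  using (nonempty?; anySubset?; _∈?_; _⊆?_; ⊆-refl; ⊆-trans; ⊆-antisym; ∪-comm; p⊂q⇒∣p∣<∣q∣; p⊆q⇒∁p⊇∁q;
         x∈p∩q⁺; x∈p∩q⁻; p∩q⊆p; p∩q⊆q; x∈p∪q⁻; p⊆p∪q; q⊆p∪q;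
         x∉p⇒x∈∁p; x∈∁p⇒x∉p; x∈p⇒x∉∁p; x∈⁅x⁆; x∈⁅y⁆⇒x≡y; ∣⁅x⁆∣≡1)
open import Data.Product using (Σ; _×_; _,_; proj₁; proj₂; ∃-syntax)
open import Data.Sum using ([_,_]′)
open import Data.Vec using (Vec; []; _∷_; lookup; tabulate; map)
open import Data.Vec.Properties using (lookup-map; lookup-zipWith; lookup∘tabulate; []=⇒lookup; lookup⇒[]=; ≡-dec)
open import Function using (id; _∘_; _⇔_; mk⇔; Equivalence)
open import Induction.WellFounded using (Acc; acc)
open import Relation.Binary.PropositionalEquality using (_≡_; refl; sym; trans; cong; cong₂; subst; subst₂)
open import Relation.Nullary using (Dec; yes; no; does; ¬_; ¬?; _×-dec_; _→-dec_)
open import Relation.Nullary.Decidable using (False; T?; toWitnessFalse; decidable-stable; does-⇔)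
open import Relation.Unary using (Decidable)
import Algebra.Properties.CommutativeMonoid.Sum as CommutativeMonoidSum

open CommutativeMonoidSum +-0-commutativeMonoid using (sum-syntax; sum-cong-≗; ∑-comm)
open Equivalence using (to; from)

𝟙 : Bool → ℕ
𝟙 false = 0
𝟙 true  = 1

∣tabulate∣≡∑ : ∀ {k} (f : Fin k → Bool) → ∣ tabulate f ∣ ≡ ∑[ i < k ] 𝟙 (f i)
∣tabulate∣≡∑ {zero}  f = refl
∣tabulate∣≡∑ {suc k} f with f zero
... | true  = cong suc (∣tabulate∣≡∑ (f ∘ suc))
... | false = ∣tabulate∣≡∑ (f ∘ suc)

∣tabulate∣≡0⇒false : ∀ {k} (f : Fin k → Bool) → ∣ tabulate f ∣ ≡ 0 → ∀ i → f i ≡ false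
∣tabulate∣≡0⇒false f ∣f∣≡0 zero with f zero
... | false = refl
∣tabulate∣≡0⇒false f ∣f∣≡0 (suc i) with f zero
... | false = ∣tabulate∣≡0⇒false (f ∘ suc) ∣f∣≡0 i

∑-mono-≤ : ∀ {k} {f g : Fin k → ℕ} → (∀ i → f i ≤ g i) → ∑[ i < k ] f i ≤ ∑[ i < k ] g i
∑-mono-≤ {zero}  f≤g = z≤n
∑-mono-≤ {suc k} f≤g = +-mono-≤ (f≤g zero) (∑-mono-≤ (f≤g ∘ suc))

∣p∪q∣≤∣p∣+∣q∣ : ∀ {n} (p q : Subset n) → ∣ p ∪ q ∣ ≤ ∣ p ∣ + ∣ q ∣
∣p∪q∣≤∣p∣+∣q∣ []          []          = z≤n
∣p∪q∣≤∣p∣+∣q∣ (true ∷ p)  (true ∷ q)  = s≤s (≤-trans (∣p∪q∣≤∣p∣+∣q∣ p q) (+-monoʳ-≤ ∣ p ∣ (n≤1+n ∣ q ∣)))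
∣p∪q∣≤∣p∣+∣q∣ (true ∷ p)  (false ∷ q) = s≤s (∣p∪q∣≤∣p∣+∣q∣ p q)
∣p∪q∣≤∣p∣+∣q∣ (false ∷ p) (true ∷ q)  = ≤-trans (s≤s (∣p∪q∣≤∣p∣+∣q∣ p q)) (≤-reflexive (sym (+-suc ∣ p ∣ ∣ q ∣)))
∣p∪q∣≤∣p∣+∣q∣ (false ∷ p) (false ∷ q) = ∣p∪q∣≤∣p∣+∣q∣ p q

m≤a⇒a+b≤m+m⇒b≤m : ∀ {m a b} → m ≤ a → a + b ≤ m + m → b ≤ m
m≤a⇒a+b≤m+m⇒b≤m {m} {a} {b} m≤a a+b≤m+m = +-cancelˡ-≤ m b m (≤-trans (+-monoˡ-≤ b m≤a) a+b≤m+m)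

T-does : ∀ {A : Set} (a? : Dec A) → T (does a?) ⇔ A
T-does (yes a) = mk⇔ (λ _ → a) _
T-does (no ¬a) = mk⇔ (λ ()) ¬a

-- The implicit argument normalises to ⊤ exactly when no subset violates P, and is then
-- filled in by evaluation.
by-exhaustion : ∀ {k} {P : Subset k → Set} (P? : Decidable P) →
                {False (anySubset? (¬? ∘ P?))} → ∀ s → P s
by-exhaustion P? {none} s = decidable-stable (P? s) (λ ¬Ps → toWitnessFalse none (s , ¬Ps))

T-∧-not : ∀ {a b} → T a → a ∧ not b ≡ false → T b
T-∧-not {true} {true}  _ _  = _
T-∧-not {true} {false} _ ()

module _ {n : ℕ} where

  ∈⇒T : ∀ {p : Subset n} {x} → x ∈ p → T (lookup p x)
  ∈⇒T x∈p = T-≡ .from ([]=⇒lookup x∈p)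

  T⇒∈ : ∀ {p : Subset n} {x} → T (lookup p x) → x ∈ p
  T⇒∈ {p} {x} t = lookup⇒[]= x p (T-≡ .to t)

  ∈-tabulate⁺ : ∀ {f : Fin n → Bool} {x} → T (f x) → x ∈ tabulate f
  ∈-tabulate⁺ {f} {x} t = T⇒∈ (subst T (sym (lookup∘tabulate f x)) t)

  ∈-tabulate⁻ : ∀ {f : Fin n → Bool} {x} → x ∈ tabulate f → T (f x)
  ∈-tabulate⁻ {f} {x} x∈ = subst T (lookup∘tabulate f x) (∈⇒T x∈)

  ⊈-witness : ∀ {p q : Subset n} → p ⊈ q → ∃[ x ] x ∈ p × x ∉ q
  ⊈-witness {p} {q} p⊈q with ¬∀⟶∃¬ n (λ x → x ∈ p → x ∈ q) (λ x → x ∈? p →-dec x ∈? q) (λ ∀x → p⊈q (∀x _))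
  ... | x , ¬[x∈p→x∈q] = x , decidable-stable (x ∈? p) (λ x∉p → ¬[x∈p→x∈q] (⊥-elim ∘ x∉p)) , ¬[x∈p→x∈q] ∘ λ x∈q _ → x∈q

  ∪-least : ∀ {p q r : Subset n} → p ⊆ r → q ⊆ r → p ∪ q ⊆ r
  ∪-least {p} {q} p⊆r q⊆r = [ p⊆r , q⊆r ]′ ∘ x∈p∪q⁻ p q

  ∪-swap : ∀ {p q r : Subset n} → p ⊆ q ∪ r → p ⊆ r ∪ q
  ∪-swap {q = q} {r} p⊆q∪r = subst (_ ⊆_) (∪-comm q r) p⊆q∪r

  p⊆q⇒∣q∣≤∣p∣⇒p≡q : ∀ {p q : Subset n} → p ⊆ q → ∣ q ∣ ≤ ∣ p ∣ → p ≡ q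
  p⊆q⇒∣q∣≤∣p∣⇒p≡q {p} {q} p⊆q ∣q∣≤∣p∣ = ⊆-antisym p⊆q (decidable-stable (q ⊆? p) q⊈p-impossible)
    where
    q⊈p-impossible : ¬ (q ⊈ p)
    q⊈p-impossible q⊈p = <⇒≱ (p⊂q⇒∣p∣<∣q∣ (p⊆q , ⊈-witness q⊈p)) ∣q∣≤∣p∣

module Extremal {n : ℕ} (_≼_ : Subset n → Subset n → Set) (_≼?_ : ∀ A B → Dec (A ≼ B))
                (≼-refl : ∀ {A} → A ≼ A) (≼-trans : ∀ {A B C} → A ≼ B → B ≼ C → A ≼ C)
                (μ : Subset n → ℕ) (μ-shrinks : ∀ {A B} → B ≼ A → ¬ A ≼ B → μ B < μ A) where

  extremal : ∀ {P : Subset n → Set} → Decidable P → ∀ {A} → P A →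
             ∃[ M ] P M × M ≼ A × (∀ {B} → P B → B ≼ M → M ≼ B)
  extremal {P} P? {A} PA = go A (<-wellFounded (μ A)) PA
    where
    go : ∀ A → Acc _<_ (μ A) → P A → ∃[ M ] P M × M ≼ A × (∀ {B} → P B → B ≼ M → M ≼ B)
    go A (acc rs) PA with anySubset? (λ B → P? B ×-dec B ≼? A ×-dec ¬? (A ≼? B))
    ... | yes (B , PB , B≼A , A⋠B) with go B (rs (μ-shrinks B≼A A⋠B)) PB
    ...   | M , PM , M≼B , M-extremal = M , PM , ≼-trans M≼B B≼A , M-extremal
    go A _ PA | no no-improvement =
      A , PA , ≼-refl , λ {B} PB B≼A → decidable-stable (A ≼? B) (λ A⋠B → no-improvement (B , PB , B≼A , A⋠B))

module _ {n : ℕ} {P : Subset n → Set} (P? : Decidable P) where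

  ⊆-minimal : ∀ {A} → P A → ∃[ M ] P M × M ⊆ A × (∀ {B} → P B → B ⊆ M → M ⊆ B)
  ⊆-minimal = Extremal.extremal _⊆_ _⊆?_ ⊆-refl ⊆-trans ∣_∣
                (λ B⊆A A⊈B → p⊂q⇒∣p∣<∣q∣ (B⊆A , ⊈-witness A⊈B)) P?

  ⊆-maximal : ∀ {A} → P A → ∃[ M ] P M × A ⊆ M × (∀ {B} → P B → M ⊆ B → B ⊆ M)
  ⊆-maximal = Extremal.extremal (λ A B → B ⊆ A) (λ A B → B ⊆? A) ⊆-refl (λ B⊆A C⊆B → ⊆-trans C⊆B B⊆A)
                (∣_∣ ∘ ∁) ∁-shrinks P?
    where
    ∁-shrinks : ∀ {A B} → A ⊆ B → B ⊈ A → ∣ ∁ B ∣ < ∣ ∁ A ∣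
    ∁-shrinks A⊆B B⊈A with ⊈-witness B⊈A
    ... | x , x∈B , x∉A = p⊂q⇒∣p∣<∣q∣ (p⊆q⇒∁p⊇∁q A⊆B , x , x∉p⇒x∈∁p x∉A , x∈p⇒x∉∁p x∈B)

-- Stated with does, so that crosses? U e is definitionally meets? e U ∧ meets? e (∁ U).
meets? : ∀ {n} → Subset n → Subset n → Bool
meets? e U = does (nonempty? (e ∩ U))

anyᶠ : ∀ {k} → (Fin k → Bool) → Bool
anyᶠ g = does (any? (T? ∘ g))

-- A hyperedge crosses a set of the Boolean algebra generated by Bs iff it meets a Venn region
-- of Bs inside the set and one outside it, so a pointwise inequality between crossing
-- indicators only depends on which regions the hyperedge meets, and can be decided by
-- evaluating all such patterns.
module VennRegions {n j : ℕ} (Bs : Vec (Subset n) j) where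

  signature : Fin n → Vec Bool j
  signature x = map (λ B → lookup B x) Bs

  _≟ˢ_ : (σ τ : Vec Bool j) → Dec (σ ≡ τ)
  _≟ˢ_ = ≡-dec _≟ᴮ_

  region : Vec Bool j → Subset n
  region τ = tabulate (λ x → does (signature x ≟ˢ τ))

  ∈-region⁺ : ∀ {x τ} → signature x ≡ τ → x ∈ region τ
  ∈-region⁺ {x} {τ} eq = ∈-tabulate⁺ (T-does (signature x ≟ˢ τ) .from eq)

  ∈-region⁻ : ∀ {x τ} → x ∈ region τ → signature x ≡ τ
  ∈-region⁻ {x} {τ} x∈ = T-does (signature x ≟ˢ τ) .to (∈-tabulate⁻ x∈)

  Describes : Subset n → (Vec Bool j → Bool) → Set
  Describes U f = ∀ x → lookup U x ≡ f (signature x)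

  describes-∁ : ∀ {U f} → Describes U f → Describes (∁ U) (not ∘ f)
  describes-∁ {U} dU x = trans (lookup-map x not U) (cong not (dU x))

  module Covering {k : ℕ} (σ : Fin k → Vec Bool j) (covers : ∀ x → ∃[ i ] σ i ≡ signature x) where

    hits : Subset n → Fin k → Bool
    hits e i = meets? e (region (σ i))

    crossesᴿ : (Vec Bool j → Bool) → (Fin k → Bool) → Bool
    crossesᴿ f h = anyᶠ (λ i → f (σ i) ∧ h i) ∧ anyᶠ (λ i → not (f (σ i)) ∧ h i)

    meets?-regions : ∀ {U f} → Describes U f → ∀ e → meets? e U ≡ anyᶠ (λ i → f (σ i) ∧ hits e i)
    meets?-regions {U} {f} dU e = does-⇔ (mk⇔ into back) (nonempty? (e ∩ U)) (any? (T? ∘ λ i → f (σ i) ∧ hits e i))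
      where
      into : Nonempty (e ∩ U) → ∃[ i ] T (f (σ i) ∧ hits e i)
      into (x , x∈e∩U) with covers x | x∈p∩q⁻ e U x∈e∩U
      ... | i , σi≡ | x∈e , x∈U =
        i , T-∧ .from (subst (T ∘ f) (sym σi≡) (subst T (dU x) (∈⇒T x∈U)) ,
                       T-does (nonempty? (e ∩ region (σ i))) .from (x , x∈p∩q⁺ (x∈e , ∈-region⁺ (sym σi≡))))
      back : ∃[ i ] T (f (σ i) ∧ hits e i) → Nonempty (e ∩ U)
      back (i , t) with T-∧ .to t
      ... | fσ , hit with T-does (nonempty? (e ∩ region (σ i))) .to hit
      ...   | x , x∈e∩R with x∈p∩q⁻ e (region (σ i)) x∈e∩R
      ...     | x∈e , x∈R = x , x∈p∩q⁺ (x∈e , T⇒∈ (subst T (sym (trans (dU x) (cong f (∈-region⁻ x∈R)))) fσ))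

    crosses?-regions : ∀ U f → Describes U f → ∀ e → crosses? U e ≡ crossesᴿ f (hits e)
    crosses?-regions U f dU e =
      cong₂ _∧_ (meets?-regions {U} {f} dU e) (meets?-regions {∁ U} {not ∘ f} (describes-∁ {U} {f} dU) e)

module Submodularity {n : ℕ} (X Y : Subset n) where
  open VennRegions (X ∷ Y ∷ [])

  allPairs : Fin 4 → Vec Bool 2
  allPairs 0F = true  ∷ true  ∷ []
  allPairs 1F = true  ∷ false ∷ []
  allPairs 2F = false ∷ true  ∷ []
  allPairs 3F = false ∷ false ∷ []

  covers : ∀ x → ∃[ i ] allPairs i ≡ lookup X x ∷ lookup Y x ∷ []
  covers x with lookup X x | lookup Y x
  ... | true  | true  = 0F , refl
  ... | true  | false = 1F , refl
  ... | false | true  = 2F , refl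
  ... | false | false = 3F , refl

  open Covering allPairs covers

  inX inY inX∩Y inX∪Y : Vec Bool 2 → Bool
  inX τ = lookup τ 0F
  inY τ = lookup τ 1F
  inX∩Y τ = inX τ ∧ inY τ
  inX∪Y τ = inX τ ∨ inY τ

  lhsᴿ rhsᴿ : (Fin 4 → Bool) → ℕ
  lhsᴿ h = 𝟙 (crossesᴿ inX∩Y h) + 𝟙 (crossesᴿ inX∪Y h)
  rhsᴿ h = 𝟙 (crossesᴿ inX h) + 𝟙 (crossesᴿ inY h)

  submodularᴿ : ∀ h → lhsᴿ h ≤ rhsᴿ h
  submodularᴿ h = by-exhaustion (λ s → lhsᴿ (lookup s) ≤? rhsᴿ (lookup s)) (tabulate h)

  submodular-pointwise : ∀ e → 𝟙 (crosses? (X ∩ Y) e) + 𝟙 (crosses? (X ∪ Y) e) ≤ 𝟙 (crosses? X e) + 𝟙 (crosses? Y e)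
  submodular-pointwise e = begin
    𝟙 (crosses? (X ∩ Y) e) + 𝟙 (crosses? (X ∪ Y) e) ≡⟨ cong₂ (λ a b → 𝟙 a + 𝟙 b) crosses-X∩Y crosses-X∪Y ⟩
    lhsᴿ (hits e)                                     ≤⟨ submodularᴿ (hits e) ⟩
    rhsᴿ (hits e)                                     ≡⟨ sym (cong₂ (λ a b → 𝟙 a + 𝟙 b) crosses-X crosses-Y) ⟩
    𝟙 (crosses? X e) + 𝟙 (crosses? Y e)               ∎
    where
    open ≤-Reasoning
    crosses-X∩Y : crosses? (X ∩ Y) e ≡ crossesᴿ inX∩Y (hits e)
    crosses-X∩Y = crosses?-regions (X ∩ Y) inX∩Y (λ x → lookup-zipWith _∧_ x X Y) e
    crosses-X∪Y : crosses? (X ∪ Y) e ≡ crossesᴿ inX∪Y (hits e)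
    crosses-X∪Y = crosses?-regions (X ∪ Y) inX∪Y (λ x → lookup-zipWith _∨_ x X Y) e
    crosses-X : crosses? X e ≡ crossesᴿ inX (hits e)
    crosses-X = crosses?-regions X inX (λ _ → refl) e
    crosses-Y : crosses? Y e ≡ crossesᴿ inY (hits e)
    crosses-Y = crosses?-regions Y inY (λ _ → refl) e

module ThreeCut {n : ℕ} (A : Subset n) (X : Fin 3 → Subset n)
                (X₀∪X₁≡A : X 0F ∪ X 1F ≡ A) (X₀∪X₂≡A : X 0F ∪ X 2F ≡ A) (X₁∪X₂≡A : X 1F ∪ X 2F ≡ A) where
  open VennRegions (A ∷ X 0F ∷ X 1F ∷ X 2F ∷ [])

  -- The signatures (membership in A, X₀, X₁, X₂) of ∁ A, of X₀ ∩ X₁ ∩ X₂, and of A ∖ Xᵢ;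
  -- since A is the union of any two Xᵢ, no other signature occurs.
  feasible : Fin 5 → Vec Bool 4
  feasible 0F = false ∷ false ∷ false ∷ false ∷ []
  feasible 1F = true  ∷ true  ∷ true  ∷ true  ∷ []
  feasible 2F = true  ∷ false ∷ true  ∷ true  ∷ []
  feasible 3F = true  ∷ true  ∷ false ∷ true  ∷ []
  feasible 4F = true  ∷ true  ∷ true  ∷ false ∷ []

  lookup-∪ : ∀ {i j} → X i ∪ X j ≡ A → ∀ x → lookup A x ≡ lookup (X i) x ∨ lookup (X j) x
  lookup-∪ {i} {j} Xi∪Xj≡A x = trans (cong (λ U → lookup U x) (sym Xi∪Xj≡A)) (lookup-zipWith _∨_ x (X i) (X j))

  classify : ∀ a p q r → a ≡ p ∨ q → a ≡ p ∨ r → a ≡ q ∨ r → ∃[ i ] feasible i ≡ a ∷ p ∷ q ∷ r ∷ []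
  classify _ false false false refl _    _  = 0F , refl
  classify _ true  true  true  refl _    _  = 1F , refl
  classify _ false true  true  refl _    _  = 2F , refl
  classify _ true  false true  refl _    _  = 3F , refl
  classify _ true  true  false refl _    _  = 4F , refl
  classify _ true  false false refl _    ()
  classify _ false true  false refl ()   _
  classify _ false false true  refl ()   _

  covers : ∀ x → ∃[ i ] feasible i ≡ signature x
  covers x = classify _ _ _ _ (lookup-∪ X₀∪X₁≡A x) (lookup-∪ X₀∪X₂≡A x) (lookup-∪ X₁∪X₂≡A x)

  open Covering feasible covers

  inA : Vec Bool 4 → Bool
  inA τ = lookup τ 0F

  inX inA∖X : Fin 3 → Vec Bool 4 → Bool
  inX i τ = lookup τ (suc i)
  inA∖X i τ = inA τ ∧ not (inX i τ)

  describes-X : ∀ i → Describes (X i) (inX i)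
  describes-X 0F _ = refl
  describes-X 1F _ = refl
  describes-X 2F _ = refl

  describes-A∖X : ∀ i → Describes (A ∩ ∁ (X i)) (inA∖X i)
  describes-A∖X i x =
    trans (lookup-zipWith _∧_ x A (∁ (X i))) (cong (lookup A x ∧_) (describes-∁ {X i} {inX i} (describes-X i) x))

  lhsᴿ rhsᴿ : (Fin 5 → Bool) → ℕ
  lhsᴿ h = 𝟙 (crossesᴿ inA h ∧ not (crossesᴿ (inX 0F) h)) + ∑[ i < 3 ] 𝟙 (crossesᴿ (inA∖X i) h)
  rhsᴿ h = ∑[ i < 3 ] 𝟙 (crossesᴿ (inX i) h)

  three-cutᴿ : ∀ h → lhsᴿ h ≤ rhsᴿ h
  three-cutᴿ h = by-exhaustion (λ s → lhsᴿ (lookup s) ≤? rhsᴿ (lookup s)) (tabulate h)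

  three-cut-pointwise : ∀ e → 𝟙 (crosses? A e ∧ not (crosses? (X 0F) e)) + ∑[ i < 3 ] 𝟙 (crosses? (A ∩ ∁ (X i)) e)
                            ≤ ∑[ i < 3 ] 𝟙 (crosses? (X i) e)
  three-cut-pointwise e = begin
    𝟙 (crosses? A e ∧ not (crosses? (X 0F) e)) + ∑[ i < 3 ] 𝟙 (crosses? (A ∩ ∁ (X i)) e)
      ≡⟨ cong₂ _+_ (cong₂ (λ a x → 𝟙 (a ∧ not x)) crosses-A (crosses-X 0F)) (sum-cong-≗ (cong 𝟙 ∘ crosses-A∖X)) ⟩
    lhsᴿ (hits e)
      ≤⟨ three-cutᴿ (hits e) ⟩
    rhsᴿ (hits e)
      ≡⟨ sum-cong-≗ (cong 𝟙 ∘ sym ∘ crosses-X) ⟩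
    ∑[ i < 3 ] 𝟙 (crosses? (X i) e) ∎
    where
    open ≤-Reasoning
    crosses-A : crosses? A e ≡ crossesᴿ inA (hits e)
    crosses-A = crosses?-regions A inA (λ _ → refl) e
    crosses-X : ∀ i → crosses? (X i) e ≡ crossesᴿ (inX i) (hits e)
    crosses-X i = crosses?-regions (X i) (inX i) (describes-X i) e
    crosses-A∖X : ∀ i → crosses? (A ∩ ∁ (X i)) e ≡ crossesᴿ (inA∖X i) (hits e)
    crosses-A∖X i = crosses?-regions (A ∩ ∁ (X i)) (inA∖X i) (describes-A∖X i) e

module DoubleCounting (G : Hypergraph) where

  #edges : (Subset (n G) → Bool) → ℕ
  #edges P = ∣ tabulate (P ∘ edge G) ∣

  ∑#edges : ∀ {p} (Ps : Fin p → Subset (n G) → Bool) →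
            ∑[ j < p ] #edges (Ps j) ≡ ∑[ i < m G ] ∑[ j < p ] 𝟙 (Ps j (edge G i))
  ∑#edges Ps = trans (sum-cong-≗ (λ j → ∣tabulate∣≡∑ (Ps j ∘ edge G))) (∑-comm (λ j i → 𝟙 (Ps j (edge G i))))

  double-counting : ∀ {p q} (Ps : Fin p → Subset (n G) → Bool) (Qs : Fin q → Subset (n G) → Bool) →
                    (∀ e → ∑[ j < p ] 𝟙 (Ps j e) ≤ ∑[ j < q ] 𝟙 (Qs j e)) →
                    ∑[ j < p ] #edges (Ps j) ≤ ∑[ j < q ] #edges (Qs j)
  double-counting Ps Qs pointwise = begin
    ∑[ j < _ ] #edges (Ps j)                    ≡⟨ ∑#edges Ps ⟩
    ∑[ i < m G ] ∑[ j < _ ] 𝟙 (Ps j (edge G i)) ≤⟨ ∑-mono-≤ (pointwise ∘ edge G) ⟩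
    ∑[ i < m G ] ∑[ j < _ ] 𝟙 (Qs j (edge G i)) ≡⟨ sym (∑#edges Qs) ⟩
    ∑[ j < _ ] #edges (Qs j)                    ∎
    where open ≤-Reasoning

  d-submodular : ∀ X Y → d G (X ∩ Y) + d G (X ∪ Y) ≤ d G X + d G Y
  d-submodular X Y = begin
    d G (X ∩ Y) + d G (X ∪ Y)       ≡⟨ cong (d G (X ∩ Y) +_) (sym (+-identityʳ _)) ⟩
    ∑[ j < 2 ] #edges (meet-join j) ≤⟨ double-counting meet-join sides pointwise ⟩
    ∑[ j < 2 ] #edges (sides j)     ≡⟨ cong (d G X +_) (+-identityʳ _) ⟩
    d G X + d G Y                   ∎
    where
    open ≤-Reasoning
    meet-join sides : Fin 2 → Subset (n G) → Bool
    meet-join 0F = crosses? (X ∩ Y)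
    meet-join 1F = crosses? (X ∪ Y)
    sides 0F = crosses? X
    sides 1F = crosses? Y
    pointwise : ∀ e → ∑[ j < 2 ] 𝟙 (meet-join j e) ≤ ∑[ j < 2 ] 𝟙 (sides j e)
    pointwise e = subst₂ _≤_ (cong (𝟙 (crosses? (X ∩ Y) e) +_) (sym (+-identityʳ _)))
                             (cong (𝟙 (crosses? X e) +_) (sym (+-identityʳ _)))
                             (Submodularity.submodular-pointwise X Y e)

  three-cut : ∀ A (X : Fin 3 → Subset (n G)) → X 0F ∪ X 1F ≡ A → X 0F ∪ X 2F ≡ A → X 1F ∪ X 2F ≡ A →
              #edges (λ e → crosses? A e ∧ not (crosses? (X 0F) e)) + ∑[ i < 3 ] d G (A ∩ ∁ (X i))
                ≤ ∑[ i < 3 ] d G (X i)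
  three-cut A X X₀∪X₁≡A X₀∪X₂≡A X₁∪X₂≡A =
    double-counting (λ { zero → λ e → crosses? A e ∧ not (crosses? (X 0F) e) ; (suc i) → crosses? (A ∩ ∁ (X i)) })
                    (crosses? ∘ X)
                    (ThreeCut.three-cut-pointwise A X X₀∪X₁≡A X₀∪X₂≡A X₁∪X₂≡A)

module MinimumCut (G : Hypergraph) (V₁ : Subset (n G)) (V₁-min : IsMinCut G V₁) where
  open DoubleCounting G

  mincut : ℕ
  mincut = d G V₁

  mincut≤ : ∀ {U} → IsCut G U → mincut ≤ d G U
  mincut≤ = proj₂ V₁-min _

  inner-cut : ∀ {U} → U ⊆ V₁ → Nonempty U → IsCut G U
  inner-cut U⊆V₁ U≠∅ with proj₂ (proj₁ V₁-min)
  ... | o , o∈∁V₁ = U≠∅ , o , x∉p⇒x∈∁p (x∈∁p⇒x∉p o∈∁V₁ ∘ U⊆V₁)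

  SameBoundary : Subset (n G) → Set
  SameBoundary B = B ⊆ V₁ × Nonempty B × δ G B ≡ δ G V₁

  sameBoundary? : Decidable SameBoundary
  sameBoundary? B = B ⊆? V₁ ×-dec nonempty? B ×-dec ≡-dec _≟ᴮ_ (δ G B) (δ G V₁)

  V₁-same : SameBoundary V₁
  V₁-same = ⊆-refl , proj₁ (proj₁ V₁-min) , refl

  module MinimalBoundary (A : Subset (n G)) (A-same : SameBoundary A)
              (A-minimal : ∀ {B} → SameBoundary B → B ⊆ A → A ⊆ B) where

    A⊆V₁ : A ⊆ V₁
    A⊆V₁ = proj₁ A-same

    d-A : d G A ≡ mincut
    d-A = cong ∣_∣ (proj₂ (proj₂ A-same))

    mincut≤inner : ∀ {Z} → Z ⊆ A → Nonempty Z → mincut ≤ d G Z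
    mincut≤inner Z⊆A Z≠∅ = mincut≤ (inner-cut (⊆-trans Z⊆A A⊆V₁) Z≠∅)

    Tight : Subset (n G) → Set
    Tight Z = Z ⊆ A × Nonempty Z × d G Z ≤ mincut

    ProperTight : Subset (n G) → Set
    ProperTight Z = Tight Z × A ⊈ Z

    properTight? : Decidable ProperTight
    properTight? Z = (Z ⊆? A ×-dec nonempty? Z ×-dec d G Z ≤? mincut) ×-dec ¬? (A ⊆? Z)

    MaximalProperTight : Subset (n G) → Set
    MaximalProperTight M = ProperTight M × (∀ {B} → ProperTight B → M ⊆ B → B ⊆ M)

    maximal-above : ∀ {Z} → ProperTight Z → ∃[ M ] MaximalProperTight M × Z ⊆ M
    maximal-above Z-proper with ⊆-maximal properTight? Z-proper
    ... | M , M-proper , Z⊆M , M-maximal = M , (M-proper , M-maximal) , Z⊆M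

    tight-∪ : ∀ {Z W} → Tight Z → Tight W → Nonempty (Z ∩ W) → Tight (Z ∪ W)
    tight-∪ {Z} {W} (Z⊆A , (z , z∈Z) , dZ≤) (W⊆A , _ , dW≤) Z∩W≠∅ =
      ∪-least Z⊆A W⊆A , (z , p⊆p∪q W z∈Z) ,
      m≤a⇒a+b≤m+m⇒b≤m (mincut≤inner (⊆-trans (p∩q⊆p Z W) Z⊆A) Z∩W≠∅)
                      (≤-trans (d-submodular Z W) (+-mono-≤ dZ≤ dW≤))

    absorb : ∀ {M Z} → MaximalProperTight M → Tight Z → Nonempty (Z ∩ M) → Z ⊈ M → A ⊆ Z ∪ M
    absorb {M} {Z} ((M-tight , _) , M-maximal) Z-tight Z∩M≠∅ Z⊈M =
      decidable-stable (A ⊆? (Z ∪ M)) λ A⊈Z∪M →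
        Z⊈M (⊆-trans (p⊆p∪q M) (M-maximal (tight-∪ Z-tight M-tight Z∩M≠∅ , A⊈Z∪M) (q⊆p∪q Z M)))

    ¬three-cover : ∀ (X : Fin 3 → Subset (n G)) → (∀ i → ProperTight (X i)) →
                   A ⊆ X 0F ∪ X 1F → A ⊆ X 0F ∪ X 2F → A ⊆ X 1F ∪ X 2F → ⊥
    ¬three-cover X X-proper A⊆X₀∪X₁ A⊆X₀∪X₂ A⊆X₁∪X₂ = proj₂ (X-proper 0F) (A-minimal X₀-same (X⊆A 0F))
      where
      X⊆A : ∀ i → X i ⊆ A
      X⊆A i = proj₁ (proj₁ (X-proper i))

      dX≤ : ∀ i → d G (X i) ≤ mincut
      dX≤ i = proj₂ (proj₂ (proj₁ (X-proper i)))

      ∪≡A : ∀ {i j} → A ⊆ X i ∪ X j → X i ∪ X j ≡ A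
      ∪≡A {i} {j} = ⊆-antisym (∪-least (X⊆A i) (X⊆A j))

      mincut≤A∖X : ∀ i → mincut ≤ d G (A ∩ ∁ (X i))
      mincut≤A∖X i with ⊈-witness (proj₂ (X-proper i))
      ... | x , x∈A , x∉X = mincut≤inner (p∩q⊆p A (∁ (X i))) (x , x∈p∩q⁺ (x∈A , x∉p⇒x∈∁p x∉X))

      missing : ℕ
      missing = #edges (λ e → crosses? A e ∧ not (crosses? (X 0F) e))

      no-missing : missing ≡ 0
      no-missing = n≤0⇒n≡0 (+-cancelʳ-≤ _ missing 0 (begin
        missing + ∑[ i < 3 ] d G (A ∩ ∁ (X i)) ≤⟨ three-cut A X (∪≡A A⊆X₀∪X₁) (∪≡A A⊆X₀∪X₂) (∪≡A A⊆X₁∪X₂) ⟩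
        ∑[ i < 3 ] d G (X i)                   ≤⟨ ∑-mono-≤ dX≤ ⟩
        ∑[ i < 3 ] mincut                      ≤⟨ ∑-mono-≤ mincut≤A∖X ⟩
        ∑[ i < 3 ] d G (A ∩ ∁ (X i))           ∎))
        where open ≤-Reasoning

      δA⊆δX₀ : δ G A ⊆ δ G (X 0F)
      δA⊆δX₀ {i} i∈δA = ∈-tabulate⁺ (T-∧-not (∈-tabulate⁻ i∈δA) (∣tabulate∣≡0⇒false _ no-missing i))

      δX₀≡δA : δ G (X 0F) ≡ δ G A
      δX₀≡δA = sym (p⊆q⇒∣q∣≤∣p∣⇒p≡q δA⊆δX₀ (subst (d G (X 0F) ≤_) (sym d-A) (dX≤ 0F)))

      X₀-same : SameBoundary (X 0F)
      X₀-same = ⊆-trans (X⊆A 0F) A⊆V₁ , proj₁ (proj₂ (proj₁ (X-proper 0F))) , trans δX₀≡δA (proj₂ (proj₂ A-same))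

    Covered : Fin (n G) → Fin (n G) → Set
    Covered s u = ∃[ Z ] ProperTight Z × s ∈ Z × u ∈ Z

    covered? : ∀ s u → Dec (Covered s u)
    covered? s u = anySubset? (λ Z → properTight? Z ×-dec s ∈? Z ×-dec u ∈? Z)

    AllCovered : Set
    AllCovered = ∀ {s u} → s ∈ A → u ∈ A → Covered s u

    covering-partner : AllCovered → ∀ {M₁ s} → MaximalProperTight M₁ → s ∈ A → s ∉ M₁ →
                     ∃[ M₂ ] MaximalProperTight M₂ × s ∈ M₂ × A ⊆ M₁ ∪ M₂
    covering-partner cover {M₁} M₁-max@((M₁-tight , _) , _) s∈A s∉M₁ with proj₁ (proj₂ M₁-tight)
    ... | t , t∈M₁ with cover s∈A (proj₁ M₁-tight t∈M₁)
    ... | Z₁ , Z₁-proper@(Z₁-tight , _) , s∈Z₁ , t∈Z₁ with maximal-above Z₁-proper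
    ... | M₂ , M₂-max , Z₁⊆M₂ = M₂ , M₂-max , Z₁⊆M₂ s∈Z₁ , A⊆M₁∪M₂
      where
      A⊆Z₁∪M₁ : A ⊆ Z₁ ∪ M₁
      A⊆Z₁∪M₁ = absorb M₁-max Z₁-tight (t , x∈p∩q⁺ (t∈Z₁ , t∈M₁)) (λ Z₁⊆M₁ → s∉M₁ (Z₁⊆M₁ s∈Z₁))
      A⊆M₁∪M₂ : A ⊆ M₁ ∪ M₂
      A⊆M₁∪M₂ = [ q⊆p∪q M₁ M₂ ∘ Z₁⊆M₂ , p⊆p∪q M₂ ]′ ∘ x∈p∪q⁻ Z₁ M₁ ∘ A⊆Z₁∪M₁

    ¬all-covered : ¬ AllCovered
    ¬all-covered cover with proj₁ (proj₂ A-same)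
    ... | s₀ , s₀∈A with cover s₀∈A s₀∈A
    ... | _ , Z₀-proper , _ with maximal-above Z₀-proper
    ... | M₁ , M₁-max , _ with ⊈-witness (proj₂ (proj₁ M₁-max))
    ... | s , s∈A , s∉M₁ with covering-partner cover M₁-max s∈A s∉M₁
    ... | M₂ , M₂-max , s∈M₂ , A⊆M₁∪M₂ with ⊈-witness (proj₂ (proj₁ M₂-max))
    ... | u , u∈A , u∉M₂ with cover s∈A u∈A
    ... | Z , Z-proper , s∈Z , u∈Z =
      ¬three-cover X X-proper A⊆M₁∪M₂ (∪-swap A⊆Z∪M₁) (∪-swap A⊆Z∪M₂)
      where
      u∈M₁ : u ∈ M₁
      u∈M₁ = [ id , ⊥-elim ∘ u∉M₂ ]′ (x∈p∪q⁻ M₁ M₂ (A⊆M₁∪M₂ u∈A))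
      A⊆Z∪M₁ : A ⊆ Z ∪ M₁
      A⊆Z∪M₁ = absorb M₁-max (proj₁ Z-proper) (u , x∈p∩q⁺ (u∈Z , u∈M₁)) (λ Z⊆M₁ → s∉M₁ (Z⊆M₁ s∈Z))
      A⊆Z∪M₂ : A ⊆ Z ∪ M₂
      A⊆Z∪M₂ = absorb M₂-max (proj₁ Z-proper) (s , x∈p∩q⁺ (s∈Z , s∈M₂)) (λ Z⊆M₂ → u∉M₂ (Z⊆M₂ u∈Z))
      X : Fin 3 → Subset (n G)
      X 0F = M₁
      X 1F = M₂
      X 2F = Z
      X-proper : ∀ i → ProperTight (X i)
      X-proper 0F = proj₁ M₁-max
      X-proper 1F = proj₁ M₂-max
      X-proper 2F = Z-proper

    uncovered-pair : ∃[ s ] ∃[ u ] s ∈ A × u ∈ A × ¬ Covered s u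
    uncovered-pair with any? (λ s → any? (λ u → s ∈? A ×-dec u ∈? A ×-dec ¬? (covered? s u)))
    ... | yes found = found
    ... | no none   = ⊥-elim (¬all-covered λ {s} {u} s∈A u∈A →
                        decidable-stable (covered? s u) (λ uncovered → none (s , u , s∈A , u∈A , uncovered)))

    module TerminalCut (T : Subset (n G)) {t} (t∈T : t ∈ T) (T⊆∁V₁ : T ⊆ ∁ V₁)
                      {s u} (s∈A : s ∈ A) (u∈A : u ∈ A) (uncovered : ¬ Covered s u) where

      S : Subset (n G)
      S = ⁅ s ⁆ ∪ ⁅ u ⁆

      s∈S : s ∈ S
      s∈S = p⊆p∪q ⁅ u ⁆ (x∈⁅x⁆ s)

      u∈S : u ∈ S
      u∈S = q⊆p∪q ⁅ s ⁆ ⁅ u ⁆ (x∈⁅x⁆ u)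

      S⊆A : S ⊆ A
      S⊆A = ∪-least (λ x∈⁅s⁆ → subst (_∈ A) (sym (x∈⁅y⁆⇒x≡y s x∈⁅s⁆)) s∈A)
                    (λ x∈⁅u⁆ → subst (_∈ A) (sym (x∈⁅y⁆⇒x≡y u x∈⁅u⁆)) u∈A)

      ∣S∣≤2 : ∣ S ∣ ≤ 2
      ∣S∣≤2 = ≤-trans (∣p∪q∣≤∣p∣+∣q∣ ⁅ s ⁆ ⁅ u ⁆) (≤-reflexive (cong₂ _+_ (∣⁅x⁆∣≡1 s) (∣⁅x⁆∣≡1 u)))

      A⊆∁T : A ⊆ ∁ T
      A⊆∁T x∈A = x∉p⇒x∈∁p (λ x∈T → x∈∁p⇒x∉p (T⊆∁V₁ x∈T) (A⊆V₁ x∈A))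

      terminal⇒cut : ∀ {B} → IsTerminalCut G S T B → IsCut G B
      terminal⇒cut (S⊆B , B⊆∁T) = (s , S⊆B s∈S) , (t , x∉p⇒x∈∁p (λ t∈B → x∈∁p⇒x∉p (B⊆∁T t∈B) t∈T))

      A-minimum : IsMinTerminalCut G S T A
      A-minimum = (S⊆A , A⊆∁T) , λ B B-terminal → subst (_≤ d G B) (sym d-A) (mincut≤ (terminal⇒cut B-terminal))

      A-source-minimal : IsSourceMinimalMinTerminalCut G S T A
      A-source-minimal = A-minimum , λ B B-minimum → ⊆-trans (A⊆A∩B B B-minimum) (p∩q⊆q A B)
        where
        A⊆A∩B : ∀ B → IsMinTerminalCut G S T B → A ⊆ A ∩ B
        A⊆A∩B B ((S⊆B , B⊆∁T) , B-min) = decidable-stable (A ⊆? (A ∩ B)) λ A⊈A∩B →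
          uncovered (A ∩ B , (A∩B-tight , A⊈A∩B) , x∈p∩q⁺ (s∈A , S⊆B s∈S) , x∈p∩q⁺ (u∈A , S⊆B u∈S))
          where
          A∪B-cut : IsCut G (A ∪ B)
          A∪B-cut = terminal⇒cut (⊆-trans S⊆A (p⊆p∪q B) , ∪-least A⊆∁T B⊆∁T)
          dB≤ : d G B ≤ mincut
          dB≤ = subst (d G B ≤_) d-A (B-min A (S⊆A , A⊆∁T))
          A∩B-tight : Tight (A ∩ B)
          A∩B-tight = p∩q⊆p A B , (s , x∈p∩q⁺ (s∈A , S⊆B s∈S)) ,
                      m≤a⇒a+b≤m+m⇒b≤m (mincut≤ A∪B-cut)
                        (≤-trans (≤-reflexive (+-comm (d G (A ∪ B)) (d G (A ∩ B))))
                                 (≤-trans (d-submodular A B) (+-mono-≤ (≤-reflexive d-A) dB≤)))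

theorem1p4 : (G : Hypergraph) → (V₁ : Subset (n G)) → IsMinCut G V₁ →
    (T : Subset (n G)) → Nonempty T → T ⊆ ∁ V₁ →
    Σ (Subset (n G)) (λ S → S ⊆ V₁ × ∣ S ∣ ≤ 2 × Nonempty S ×
      Σ (Subset (n G)) (λ A → IsSourceMinimalMinTerminalCut G S T A ×
        δ G A ≡ δ G V₁ × A ⊆ V₁))
theorem1p4 G V₁ V₁-min T (t , t∈T) T⊆∁V₁ =
  let (A , A-same , _ , A-minimal) = ⊆-minimal sameBoundary? V₁-same
      open MinimalBoundary A A-same A-minimal
      (s , u , s∈A , u∈A , uncovered) = uncovered-pair
      open TerminalCut T t∈T T⊆∁V₁ s∈A u∈A uncovered
  in S , ⊆-trans S⊆A A⊆V₁ , ∣S∣≤2 , (s , s∈S) , A , A-source-minimal , proj₂ (proj₂ A-same) , A⊆V₁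
  where open MinimumCut G V₁ V₁-min
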